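{- Let $n\ge 4$ and $W_n=\{\pi\in S_n:\ \pi_1\pi_2\pi_3\pi_4\notin\{1342,1432,2341,2431\}\}$. There is an involution $\varphi$ on $W_n$ such that for every $\pi\in W_n$, $\mathrm{nwnm}(\pi)$ and $\mathrm{nwnm}(\varphi(\pi))$ have different parities.
   Context: $S_n$ is the set of permutations $\pi=\pi_1\cdots\pi_n$ of $\{1,\dots,n\}$. For $\pi\in S_n$, $\pi_i$ is a mid-point if there exist $j<i<k$ with $\pi_j>\pi_i>\pi_k$. $\mathrm{nwnm}(\pi)$ is the number of indices $i$ with $\pi_i<i$ such that $\pi_i$ is not a mid-point. -}

module Defs where

open import Data.Nat using (ℕ; zero; suc; _<_; _>_; _<?_; _≤_)
open import Data.Fin using (Fin; toℕ)
open import Data.Fin.Properties using (<-cmp)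
open import Data.Vec using (Vec; lookup; toList; _∷_; [])
open import Data.List using (List; length; filter; allFin)
open import Data.List.Relation.Unary.All using (All)
open import Data.List.Relation.Unary.Unique.Propositional using (Unique)
open import Data.Product using (Σ; ∃; _×_; _,_)
open import Relation.Nullary using (¬_; Dec; yes; no)
open import Relation.Nullary.Decidable using (_×-dec_; ¬?)
open import Relation.Binary.PropositionalEquality using (_≡_; _≢_)
import Data.Fin as F

IsPerm : (n : ℕ) → Vec ℕ n → Set
IsPerm n v = All (λ x → 1 ≤ x × x ≤ n) (toList v) × Unique (toList v)

Perm : ℕ → Set
Perm n = Σ (Vec ℕ n) (IsPerm n)

-- 1-based value πᵢ at (0-based) position i : Fin n, i.e. πᵢ₊₁.
val : ∀ {n} → Perm n → Fin n → ℕ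
val (v , _) i = lookup v i

MidPoint : ∀ {n} → Perm n → Fin n → Set
MidPoint {n} π i =
  (Σ (Fin n) λ j → (j F.< i) × (val π j > val π i)) ×
  (Σ (Fin n) λ k → (i F.< k) × (val π i > val π k))

open import Data.Fin.Properties using (any?)
open import Data.Nat.Properties using () renaming (_<?_ to _<ℕ?_)
import Data.Fin.Properties as FP

MidPoint? : ∀ {n} (π : Perm n) (i : Fin n) → Dec (MidPoint π i)
MidPoint? {n} π i =
  any? (λ j → (j FP.<? i) ×-dec (val π i <ℕ? val π j)) ×-dec
  any? (λ k → (i FP.<? k) ×-dec (val π k <ℕ? val π i))

-- index i (1-based position i+1) counts when πᵢ < i and πᵢ is not a mid-point
Counted : ∀ {n} → Perm n → Fin n → Set
Counted π i = (val π i < suc (toℕ i)) × ¬ MidPoint π i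

Counted? : ∀ {n} (π : Perm n) (i : Fin n) → Dec (Counted π i)
Counted? π i = (val π i <ℕ? suc (toℕ i)) ×-dec ¬? (MidPoint? π i)

nwnm : ∀ {n} → Perm n → ℕ
nwnm {n} π = length (filter (Counted? π) (allFin n))

BadPrefix : ∀ {n} → Vec ℕ (4 Data.Nat.+ n) → Set
BadPrefix (a ∷ b ∷ c ∷ d ∷ _) =
  ((a ≡ 1) × (b ≡ 3) × (c ≡ 4) × (d ≡ 2)) Data.Sum.⊎
  (((a ≡ 1) × (b ≡ 4) × (c ≡ 3) × (d ≡ 2)) Data.Sum.⊎
  (((a ≡ 2) × (b ≡ 3) × (c ≡ 4) × (d ≡ 1)) Data.Sum.⊎
   ((a ≡ 2) × (b ≡ 4) × (c ≡ 3) × (d ≡ 1))))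
  where import Data.Sum

W : (m : ℕ) → Set
W m = Σ (Perm (4 Data.Nat.+ m)) λ π → ¬ BadPrefix (Data.Product.proj₁ π)

perm : ∀ {m} → W m → Perm (4 Data.Nat.+ m)
perm (π , _) = π

word : ∀ {m} → W m → Vec ℕ (4 Data.Nat.+ m)
word ((v , _) , _) = v

module Submission where

-- φ interchanges two values u < v of π, chosen from its first four entries a x y z: (1 2) when a ∉ {1, 2}
-- or {a, x} = {1, 2}; otherwise, writing {a, b} = {1, 2}: (3 4) when y = b and {x, z} = {3, 4}, (b 3)
-- when x ≥ 4, and (b 4) when x = 3. The image of π is assigned the same pair, so φ is an involution; the
-- four excluded prefixes are exactly the ones for which this fails.
--
-- Position k counts towards nwnm iff π_k < k and every smaller value lies to the left of k. Interchanging u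
-- and v preserves this at every other position as long as the values strictly between u and v sit at
-- positions k with π_k ≥ k. Of the two positions e < L holding u and v, in the permutation with v at e
-- only L counts, while in the one with u at e the positions e and L count together or not at all; so the
-- parity of nwnm changes.

open import Defs
open import Data.Empty using (⊥; ⊥-elim)
open import Data.Fin as F using (Fin; toℕ; fromℕ<; punchIn; punchOut; inject≤)
open import Data.Fin.Patterns using (0F; 1F; 2F; 3F)
import Data.Fin.Properties as FP
open import Data.List using (length; filter; tabulate)
open import Data.List.Relation.Unary.All using (All; _∷_)
import Data.List.Relation.Unary.All as All
import Data.List.Relation.Unary.All.Properties as All
open import Data.List.Relation.Unary.AllPairs using (_∷_)
open import Data.List.Relation.Unary.Unique.Propositional using (Unique)
import Data.List.Relation.Unary.Unique.Propositional.Properties as Unique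
open import Data.Nat using (ℕ; zero; suc; _+_; _*_; _≤_; _<_; _%_; z≤n; s≤s; s≤s⁻¹; _≟_; _<?_)
open import Data.Nat.DivMod using (%-distribˡ-+; [m+kn]%n≡m%n)
open import Data.Nat.Properties
open import Algebra.Properties.CommutativeMonoid.Sum +-0-commutativeMonoid using (sum; sum-remove; sum-cong-≗)
open import Algebra.Properties.CommutativeSemigroup +-commutativeSemigroup using (xy∙z≈zy∙x; xy∙z≈xz∙y; xy∙z≈x∙zy)
open import Data.Product using (Σ; ∃; ∃₂; _×_; _,_; proj₁; proj₂)
open import Data.Sum using (_⊎_; inj₁; inj₂; [_,_])
open import Data.Vec using (Vec; lookup; toList; _∷_; map)
open import Data.Vec.Functional using (updateAt)
open import Data.Vec.Functional.Properties using (updateAt-updates; updateAt-minimal)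
open import Data.Vec.Properties using (lookup-map; toList-map; map-∘; map-cong; map-id)
open import Function using (_∘_; const)
open import Function.Definitions using (Injective)
open import Relation.Binary using (tri<; tri≈; tri>)
open import Relation.Binary.PropositionalEquality hiding ([_])
open import Relation.Nullary using (¬_; Dec; yes; no; _×-dec_; _⊎-dec_; contradiction)

transpose : ℕ → ℕ → ℕ → ℕ
transpose u v x with x ≟ u
... | yes _ = v
... | no _ with x ≟ v
...   | yes _ = u
...   | no _ = x

module _ {u v : ℕ} where

  transpose-u : transpose u v u ≡ v
  transpose-u with u ≟ u
  ... | yes _ = refl
  ... | no u≢u = contradiction refl u≢u

  transpose-v : transpose u v v ≡ u
  transpose-v with v ≟ u
  ... | yes v≡u = v≡u
  ... | no _ with v ≟ v
  ...   | yes _ = refl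
  ...   | no v≢v = contradiction refl v≢v

  transpose-fixes : ∀ {x} → x ≢ u → x ≢ v → transpose u v x ≡ x
  transpose-fixes {x} x≢u x≢v with x ≟ u
  ... | yes x≡u = contradiction x≡u x≢u
  ... | no _ with x ≟ v
  ...   | yes x≡v = contradiction x≡v x≢v
  ...   | no _ = refl

  transpose-involutive : ∀ x → transpose u v (transpose u v x) ≡ x
  transpose-involutive x with x ≟ u
  ... | yes refl = transpose-v
  ... | no x≢u with x ≟ v
  ...   | yes refl = transpose-u
  ...   | no x≢v = transpose-fixes x≢u x≢v

  transpose-injective : ∀ {x y} → transpose u v x ≡ transpose u v y → x ≡ y
  transpose-injective {x} {y} eq = begin
    x                                   ≡⟨ transpose-involutive x ⟨
    transpose u v (transpose u v x)     ≡⟨ cong (transpose u v) eq ⟩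
    transpose u v (transpose u v y)     ≡⟨ transpose-involutive y ⟩
    y                                   ∎
    where open ≡-Reasoning

  transpose-inverse : ∀ {x y} → transpose u v x ≡ y → x ≡ transpose u v y
  transpose-inverse {x} refl = sym (transpose-involutive x)

transpose-<-outside : ∀ {u v w x} → u < v → w < u ⊎ v < w → transpose u v x < w → x < w
transpose-<-outside {u} {v} {w} {x} u<v outside lt with x ≟ u | outside
... | yes refl | inj₁ w<u = contradiction (<-trans lt (<-trans w<u u<v)) (<-irrefl refl)
... | yes refl | inj₂ v<w = <-trans u<v v<w
... | no _     | _ with x ≟ v | outside
...   | yes refl | inj₁ w<u = contradiction w<u (<-asym lt)
...   | yes refl | inj₂ v<w = v<w
...   | no _     | _        = lt

transpose-fixes-image : ∀ {u v x} → transpose u v x ≢ u → transpose u v x ≢ v → transpose u v x ≡ x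
transpose-fixes-image {x = x} y≢u y≢v = trans (sym (transpose-fixes y≢u y≢v)) (transpose-involutive x)

injective⇒surjective : ∀ {n} (f : Fin n → Fin n) → Injective _≡_ _≡_ f → ∀ y → ∃ λ x → f x ≡ y
injective⇒surjective {suc n} f f-inj y with FP.any? (λ x → f x FP.≟ y)
... | yes found = found
... | no missed = ⊥-elim (<-irrefl refl (FP.injective⇒≤ squeezed-injective))
  where
  y≢f : ∀ x → y ≢ f x
  y≢f x y≡fx = missed (x , sym y≡fx)
  squeezed-injective : Injective _≡_ _≡_ (λ x → punchOut (y≢f x))
  squeezed-injective eq = f-inj (FP.punchOut-injective (y≢f _) (y≢f _) eq)

lookup-All : ∀ {n} {P : ℕ → Set} (w : Vec ℕ n) → All P (toList w) → ∀ i → P (lookup w i)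
lookup-All (_ ∷ _) (px ∷ _)   F.zero    = px
lookup-All (_ ∷ w) (_ ∷ pxs) (F.suc i) = lookup-All w pxs i

lookup-injective : ∀ {n} (w : Vec ℕ n) → Unique (toList w) → Injective _≡_ _≡_ (lookup w)
lookup-injective (_ ∷ _) _          {F.zero}  {F.zero}  _  = refl
lookup-injective (_ ∷ w) (x∉w ∷ _)  {F.zero}  {F.suc j} eq = contradiction eq (lookup-All w x∉w j)
lookup-injective (_ ∷ w) (x∉w ∷ _)  {F.suc i} {F.zero}  eq = contradiction (sym eq) (lookup-All w x∉w i)
lookup-injective (_ ∷ w) (_ ∷ uniq) {F.suc i} {F.suc j} eq = cong F.suc (lookup-injective w uniq eq)

predFin : ∀ {n x} → 1 ≤ x → x ≤ n → Fin n
predFin {x = suc _} _ x≤n = fromℕ< x≤n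

suc-toℕ-predFin : ∀ {n x} (1≤x : 1 ≤ x) (x≤n : x ≤ n) → suc (toℕ (predFin 1≤x x≤n)) ≡ x
suc-toℕ-predFin {x = suc _} _ x≤n = cong suc (FP.toℕ-fromℕ< x≤n)

module _ {n : ℕ} (π : Perm n) where

  val-bounded : ∀ i → 1 ≤ val π i × val π i ≤ n
  val-bounded = lookup-All (proj₁ π) (proj₁ (proj₂ π))

  val-injective : Injective _≡_ _≡_ (val π)
  val-injective = lookup-injective (proj₁ π) (proj₂ (proj₂ π))

  private
    entry : Fin n → Fin n
    entry i = predFin (proj₁ (val-bounded i)) (proj₂ (val-bounded i))

    suc-toℕ-entry : ∀ i → suc (toℕ (entry i)) ≡ val π i
    suc-toℕ-entry i = suc-toℕ-predFin (proj₁ (val-bounded i)) (proj₂ (val-bounded i))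

    entry-injective : Injective _≡_ _≡_ entry
    entry-injective eq = val-injective (begin
      val π _                ≡⟨ suc-toℕ-entry _ ⟨
      suc (toℕ (entry _))    ≡⟨ cong (suc ∘ toℕ) eq ⟩
      suc (toℕ (entry _))    ≡⟨ suc-toℕ-entry _ ⟩
      val π _                ∎)
      where open ≡-Reasoning

  val-surjective : ∀ {x} → 1 ≤ x → x ≤ n → ∃ λ i → val π i ≡ x
  val-surjective 1≤x x≤n with injective⇒surjective entry entry-injective (predFin 1≤x x≤n)
  ... | i , entry-i = i , (begin
    val π i                          ≡⟨ suc-toℕ-entry i ⟨
    suc (toℕ (entry i))              ≡⟨ cong (suc ∘ toℕ) entry-i ⟩
    suc (toℕ (predFin 1≤x x≤n))      ≡⟨ suc-toℕ-predFin 1≤x x≤n ⟩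
    _                                ∎)
    where open ≡-Reasoning

  -- the i entries left of position i are distinct values in [1, val π i), so there are at most val π i ∸ 1 of them
  smaller-before⇒above-diagonal : ∀ {i} → (∀ j → j F.< i → val π j < val π i) → toℕ i < val π i
  smaller-before⇒above-diagonal {i} smaller = begin-strict
    toℕ i                 ≤⟨ FP.injective⇒≤ shrink-injective ⟩
    toℕ (entry i)         <⟨ n<1+n _ ⟩
    suc (toℕ (entry i))   ≡⟨ suc-toℕ-entry i ⟩
    val π i               ∎
    where
    open ≤-Reasoning
    before : Fin (toℕ i) → Fin n
    before k = inject≤ k (<⇒≤ (FP.toℕ<n i))
    before-< : ∀ k → before k F.< i
    before-< k = subst (_< toℕ i) (sym (FP.toℕ-inject≤ k _)) (FP.toℕ<n k)
    entry-< : ∀ k → toℕ (entry (before k)) < toℕ (entry i)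
    entry-< k = s≤s⁻¹ (subst₂ _<_ (sym (suc-toℕ-entry _)) (sym (suc-toℕ-entry i))
                                   (smaller (before k) (before-< k)))
    shrink : Fin (toℕ i) → Fin (toℕ (entry i))
    shrink k = fromℕ< (entry-< k)
    shrink-injective : Injective _≡_ _≡_ shrink
    shrink-injective {k} {l} eq = FP.inject≤-injective _ _ k l (entry-injective (FP.toℕ-injective (begin-equality
      toℕ (entry (before k))  ≡⟨ FP.toℕ-fromℕ< (entry-< k) ⟨
      toℕ (shrink k)          ≡⟨ cong toℕ eq ⟩
      toℕ (shrink l)          ≡⟨ FP.toℕ-fromℕ< (entry-< l) ⟩
      toℕ (entry (before l))  ∎)))

  larger-before : ∀ {i} → val π i ≤ toℕ i → ∃ λ j → j F.< i × val π i < val π j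
  larger-before {i} below with FP.any? (λ j → (j FP.<? i) ×-dec (val π i <? val π j))
  ... | yes found = found
  ... | no none = contradiction below (<⇒≱ (smaller-before⇒above-diagonal smaller))
    where
    smaller : ∀ j → j F.< i → val π j < val π i
    smaller j j<i with <-cmp (val π j) (val π i)
    ... | tri< lt _ _ = lt
    ... | tri≈ _ eq _ = contradiction (val-injective eq) (FP.<⇒≢ j<i)
    ... | tri> _ _ gt = contradiction (j , j<i , gt) none

  counted-intro : ∀ {i} → val π i ≤ toℕ i → (∀ j → val π j < val π i → j F.< i) → Counted π i
  counted-intro below left = s≤s below , λ { (_ , k , i<k , smaller) → <-asym i<k (left k smaller) }

  counted⇒below-diagonal : ∀ {i} → Counted π i → val π i ≤ toℕ i
  counted⇒below-diagonal = s≤s⁻¹ ∘ proj₁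

  counted⇒smaller-left : ∀ {i j} → Counted π i → val π j < val π i → j F.< i
  counted⇒smaller-left {i} {j} (below , not-mid) smaller with FP.<-cmp j i
  ... | tri< j<i _ _ = j<i
  ... | tri≈ _ refl _ = contradiction smaller (<-irrefl refl)
  ... | tri> _ _ i<j = contradiction (larger-before (s≤s⁻¹ below) , j , i<j , smaller) not-mid

indicator : ∀ {p} {P : Set p} → Dec P → ℕ
indicator (yes _) = 1
indicator (no _)  = 0

indicator-⇔ : ∀ {p q} {P : Set p} {Q : Set q} (P? : Dec P) (Q? : Dec Q) → (P → Q) → (Q → P) → indicator P? ≡ indicator Q?
indicator-⇔ (yes _) (yes _) _   _   = refl
indicator-⇔ (yes p) (no ¬q) p→q _   = contradiction (p→q p) ¬q
indicator-⇔ (no ¬p) (yes q) _   q→p = contradiction (q→p q) ¬p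
indicator-⇔ (no _)  (no _)  _   _   = refl

indicator-yes : ∀ {p} {P : Set p} (P? : Dec P) → P → indicator P? ≡ 1
indicator-yes (yes _) _ = refl
indicator-yes (no ¬p) p = contradiction p ¬p

indicator-no : ∀ {p} {P : Set p} (P? : Dec P) → ¬ P → indicator P? ≡ 0
indicator-no (yes p) ¬p = contradiction p ¬p
indicator-no (no _)  _  = refl

length-filter-tabulate : ∀ {n p} {A : Set} {P : A → Set p} (P? : ∀ x → Dec (P x)) (f : Fin n → A) →
                         length (filter P? (tabulate f)) ≡ sum (indicator ∘ P? ∘ f)
length-filter-tabulate {zero}  P? f = refl
length-filter-tabulate {suc n} P? f with P? (f F.zero)
... | yes _ = cong suc (length-filter-tabulate P? (f ∘ F.suc))
... | no _  = length-filter-tabulate P? (f ∘ F.suc)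

nwnm≡sum : ∀ {n} (π : Perm n) → nwnm π ≡ sum (indicator ∘ Counted? π)
nwnm≡sum π = length-filter-tabulate (Counted? π) (λ i → i)

sum-differ-at : ∀ {n} {f g : Fin n → ℕ} p → (∀ i → i ≢ p → f i ≡ g i) → sum f + g p ≡ sum g + f p
sum-differ-at {suc _} {f} {g} p agree = begin
  sum f + g p                        ≡⟨ cong (_+ g p) (sum-remove f) ⟩
  f p + sum (f ∘ punchIn p) + g p    ≡⟨ cong (λ s → f p + s + g p) (sum-cong-≗ λ k → agree _ (FP.punchInᵢ≢i p k)) ⟩
  f p + sum (g ∘ punchIn p) + g p    ≡⟨ xy∙z≈zy∙x (f p) _ (g p) ⟩
  g p + sum (g ∘ punchIn p) + f p    ≡⟨ cong (_+ f p) (sum-remove g) ⟨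
  sum g + f p                        ∎
  where open ≡-Reasoning

sum-differ-at₂ : ∀ {n} {f g : Fin n → ℕ} {p r} → p ≢ r → (∀ i → i ≢ p → i ≢ r → f i ≡ g i) →
                 sum f + (g p + g r) ≡ sum g + (f p + f r)
sum-differ-at₂ {f = f} {g} {p} {r} p≢r agree = begin
  sum f + (g p + g r)    ≡⟨ +-assoc (sum f) _ _ ⟨
  sum f + g p + g r      ≡⟨ cong (λ x → sum f + x + g r) h-p ⟨
  sum f + h p + g r      ≡⟨ cong (_+ g r) (sum-differ-at p f≡h) ⟩
  sum h + f p + g r      ≡⟨ xy∙z≈xz∙y (sum h) _ _ ⟩
  sum h + g r + f p      ≡⟨ cong (_+ f p) (sum-differ-at r h≡g) ⟩
  sum g + h r + f p      ≡⟨ cong (λ x → sum g + x + f p) (updateAt-minimal r p f (p≢r ∘ sym)) ⟩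
  sum g + f r + f p      ≡⟨ xy∙z≈x∙zy (sum g) _ _ ⟩
  sum g + (f p + f r)    ∎
  where
  open ≡-Reasoning
  h : Fin _ → ℕ
  h = updateAt f p (const (g p))
  h-p : h p ≡ g p
  h-p = updateAt-updates p f
  f≡h : ∀ i → i ≢ p → f i ≡ h i
  f≡h i i≢p = sym (updateAt-minimal i p f i≢p)
  h≡g : ∀ i → i ≢ r → h i ≡ g i
  h≡g i i≢r with i FP.≟ p
  ... | yes refl = h-p
  ... | no i≢p = trans (updateAt-minimal i p f i≢p) (agree i i≢p i≢r)

%2-suc-≢ : ∀ n → suc n % 2 ≢ n % 2
%2-suc-≢ zero          = λ ()
%2-suc-≢ (suc zero)    = λ ()
%2-suc-≢ (suc (suc n)) = %2-suc-≢ n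

parity-differs : ∀ {m n} k → m + 1 ≡ n + (k + k) → m % 2 ≢ n % 2
parity-differs {m} {n} k eq m≡n = %2-suc-≢ n (begin
  suc n % 2            ≡⟨ cong (_% 2) (+-comm 1 n) ⟩
  (n + 1) % 2          ≡⟨ %-distribˡ-+ n 1 2 ⟩
  (n % 2 + 1) % 2      ≡⟨ cong (λ x → (x + 1) % 2) m≡n ⟨
  (m % 2 + 1) % 2      ≡⟨ %-distribˡ-+ m 1 2 ⟨
  (m + 1) % 2          ≡⟨ cong (_% 2) eq ⟩
  (n + (k + k)) % 2    ≡⟨ cong (λ x → (n + x) % 2) (trans (cong (k +_) (sym (+-identityʳ k))) (*-comm 2 k)) ⟩
  (n + k * 2) % 2      ≡⟨ [m+kn]%n≡m%n n k 2 ⟩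
  n % 2                ∎)
  where open ≡-Reasoning

Swapped : ∀ {n} → Perm n → Perm n → ℕ → ℕ → Set
Swapped π π' u v = ∀ i → val π' i ≡ transpose u v (val π i)

BetweenAbove : ∀ {n} → Perm n → ℕ → ℕ → Set
BetweenAbove π u v = ∀ i → u < val π i → val π i < v → toℕ i < val π i

module _ {n} (π π' : Perm n) {u v : ℕ} (u<v : u < v) (swapped : Swapped π π' u v) where

  swapped-sym : Swapped π' π u v
  swapped-sym i = trans (sym (transpose-involutive (val π i))) (cong (transpose u v) (sym (swapped i)))

  val-unswapped : ∀ {i} → val π i ≢ u → val π i ≢ v → val π' i ≡ val π i
  val-unswapped {i} ≢u ≢v = trans (swapped i) (transpose-fixes ≢u ≢v)

  between-above-sym : BetweenAbove π u v → BetweenAbove π' u v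
  between-above-sym between i u<π'i π'i<v = subst (toℕ i <_) (sym same) (between i (subst (u <_) same u<π'i) (subst (_< v) same π'i<v))
    where
    same : val π' i ≡ val π i
    same = trans (swapped i) (transpose-fixes-image (λ eq → <-irrefl (sym eq) (subst (u <_) (swapped i) u<π'i))
                                                     (λ eq → <-irrefl eq (subst (_< v) (swapped i) π'i<v)))

  counted-unswapped : BetweenAbove π u v → ∀ {i} → val π i ≢ u → val π i ≢ v → Counted π i → Counted π' i
  counted-unswapped between {i} ≢u ≢v counted = counted-intro π' (subst (_≤ toℕ i) (sym same) below) left
    where
    same = val-unswapped ≢u ≢v
    below = counted⇒below-diagonal π counted
    outside : val π i < u ⊎ v < val π i
    outside with <-cmp (val π i) u | <-cmp (val π i) v
    ... | tri< lt _ _ | _           = inj₁ lt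
    ... | tri≈ _ eq _ | _           = contradiction eq ≢u
    ... | tri> _ _ _  | tri> _ _ gt = inj₂ gt
    ... | tri> _ _ _  | tri≈ _ eq _ = contradiction eq ≢v
    ... | tri> _ _ gt | tri< lt _ _ = contradiction below (<⇒≱ (between i gt lt))
    left : ∀ j → val π' j < val π' i → j F.< i
    left j lt = counted⇒smaller-left π counted (transpose-<-outside u<v outside (subst₂ _<_ (swapped j) same lt))

HoldsPair : ∀ {n} → Perm n → Fin n → Fin n → ℕ → ℕ → Set
HoldsPair π e L u v = (val π e ≡ u × val π L ≡ v) ⊎ (val π e ≡ v × val π L ≡ u)

-- the two configurations in which the permutation with u at e counts either both or neither of e and L
data Placement {n} (π : Perm n) (u v : ℕ) (e L : Fin n) : Set where
  below-diagonal : u ≤ toℕ e → v ≤ toℕ L → (∀ j → val π j < u → j F.< e) → Placement π u v e L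
  interlaced     : toℕ e < u → u ≤ toℕ L → toℕ L < v → Placement π u v e L

module _ {n} (π π' : Perm n) {u v : ℕ} (u<v : u < v) (swapped : Swapped π π' u v) (between : BetweenAbove π u v) where

  private
    swapped' = swapped-sym π π' u<v swapped
    between' = between-above-sym π π' u<v swapped between

  nwnm-transpose : ∀ {p r} → val π p ≡ u → val π r ≡ v →
    nwnm π + (indicator (Counted? π' p) + indicator (Counted? π' r)) ≡
    nwnm π' + (indicator (Counted? π p) + indicator (Counted? π r))
  nwnm-transpose {p} {r} πp πr = begin
    nwnm π + _                                     ≡⟨ cong (_+ _) (nwnm≡sum π) ⟩
    sum (indicator ∘ Counted? π) + _               ≡⟨ sum-differ-at₂ p≢r same-elsewhere ⟩
    sum (indicator ∘ Counted? π') + _              ≡⟨ cong (_+ _) (nwnm≡sum π') ⟨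
    nwnm π' + _                                    ∎
    where
    open ≡-Reasoning
    p≢r : p ≢ r
    p≢r refl = <-irrefl (trans (sym πp) πr) u<v
    same-elsewhere : ∀ i → i ≢ p → i ≢ r → indicator (Counted? π i) ≡ indicator (Counted? π' i)
    same-elsewhere i i≢p i≢r = indicator-⇔ _ _ (counted-unswapped π π' u<v swapped between ≢u ≢v)
      (counted-unswapped π' π u<v swapped' between' (≢u ∘ trans (sym same)) (≢v ∘ trans (sym same)))
      where
      ≢u : val π i ≢ u
      ≢u eq = i≢p (val-injective π (trans eq (sym πp)))
      ≢v : val π i ≢ v
      ≢v eq = i≢r (val-injective π (trans eq (sym πr)))
      same : val π' i ≡ val π i
      same = val-unswapped π π' u<v swapped ≢u ≢v

  module _ {e L} (e<L : e F.< L) (πe : val π e ≡ u) (πL : val π L ≡ v)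
           (before-L : ∀ j → val π j < v → val π j ≢ u → j F.< L) where

    private
      π'e : val π' e ≡ v
      π'e = trans (swapped e) (trans (cong (transpose u v) πe) (transpose-u {u} {v}))
      π'L : val π' L ≡ u
      π'L = trans (swapped L) (trans (cong (transpose u v) πL) (transpose-v {u} {v}))

    transposed-e-uncounted : ¬ Counted π' e
    transposed-e-uncounted counted = <-asym e<L (counted⇒smaller-left π' counted (subst₂ _<_ (sym π'L) (sym π'e) u<v))

    transposed-L-counted : u ≤ toℕ L → Counted π' L
    transposed-L-counted u≤L = counted-intro π' (subst (_≤ toℕ L) (sym π'L) u≤L) left
      where
      left : ∀ j → val π' j < val π' L → j F.< L
      left j lt = before-L j (subst (_< v) same (<-trans below-u u<v)) (<⇒≢ below-u ∘ trans same)
        where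
        below-u : val π' j < u
        below-u = subst (val π' j <_) π'L lt
        same : val π' j ≡ val π j
        same = trans (swapped j) (transpose-fixes-image (<⇒≢ below-u ∘ trans (swapped j))
                                                        (<⇒≢ (<-trans below-u u<v) ∘ trans (swapped j)))

    same-status : Placement π u v e L → indicator (Counted? π e) ≡ indicator (Counted? π L)
    same-status (below-diagonal u≤e v≤L before-e) = trans (indicator-yes _ counted-e) (sym (indicator-yes _ counted-L))
      where
      counted-e : Counted π e
      counted-e = counted-intro π (subst (_≤ toℕ e) (sym πe) u≤e) λ j lt → before-e j (subst (val π j <_) πe lt)
      counted-L : Counted π L
      counted-L = counted-intro π (subst (_≤ toℕ L) (sym πL) v≤L) left
        where
        left : ∀ j → val π j < val π L → j F.< L
        left j lt with val π j ≟ u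
        ... | yes πj≡u = subst (F._< L) (val-injective π (trans πe (sym πj≡u))) e<L
        ... | no πj≢u  = before-L j (subst (val π j <_) πL lt) πj≢u
    same-status (interlaced e<u _ L<v) = trans (indicator-no _ ¬counted-e) (sym (indicator-no _ ¬counted-L))
      where
      ¬counted-e : ¬ Counted π e
      ¬counted-e counted = <⇒≱ e<u (subst (_≤ toℕ e) πe (counted⇒below-diagonal π counted))
      ¬counted-L : ¬ Counted π L
      ¬counted-L counted = <⇒≱ L<v (subst (_≤ toℕ L) πL (counted⇒below-diagonal π counted))

    parity-flips-ordered : Placement π u v e L → nwnm π % 2 ≢ nwnm π' % 2
    parity-flips-ordered placement = parity-differs {nwnm π} {nwnm π'} (ι e) (begin
      nwnm π + 1                 ≡⟨ cong (nwnm π +_) (cong₂ _+_ ι'e≡0 ι'L≡1) ⟨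
      nwnm π + (ι' e + ι' L)     ≡⟨ nwnm-transpose πe πL ⟩
      nwnm π' + (ι e + ι L)      ≡⟨ cong (λ x → nwnm π' + (ι e + x)) (same-status placement) ⟨
      nwnm π' + (ι e + ι e)      ∎)
      where
      open ≡-Reasoning
      ι ι' : Fin n → ℕ
      ι  = indicator ∘ Counted? π
      ι' = indicator ∘ Counted? π'
      u≤L : Placement π u v e L → u ≤ toℕ L
      u≤L (below-diagonal u≤e _ _) = ≤-trans u≤e (<⇒≤ e<L)
      u≤L (interlaced _ u≤L _)     = u≤L
      ι'e≡0 : ι' e ≡ 0
      ι'e≡0 = indicator-no _ transposed-e-uncounted
      ι'L≡1 : ι' L ≡ 1
      ι'L≡1 = indicator-yes _ (transposed-L-counted (u≤L placement))

transpose-flips-nwnm-parity : ∀ {n} (π π' : Perm n) {u v} → u < v → Swapped π π' u v → BetweenAbove π u v →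
  ∀ {e L} → e F.< L → HoldsPair π e L u v →
  (∀ j → val π j < v → val π j ≢ u → j F.< L) → Placement π u v e L → nwnm π % 2 ≢ nwnm π' % 2
transpose-flips-nwnm-parity π π' u<v swapped between e<L (inj₁ (πe , πL)) before-L placement =
  parity-flips-ordered π π' u<v swapped between e<L πe πL before-L placement
transpose-flips-nwnm-parity π π' {u} {v} u<v swapped between {e} {L} e<L (inj₂ (πe , πL)) before-L placement =
  ≢-sym (parity-flips-ordered π' π u<v swapped' (between-above-sym π π' u<v swapped between)
                              e<L π'e π'L before-L' (placement' placement))
  where
  swapped' = swapped-sym π π' u<v swapped
  π'e : val π' e ≡ u
  π'e = trans (swapped e) (trans (cong (transpose u v) πe) (transpose-v {u} {v}))
  π'L : val π' L ≡ v
  π'L = trans (swapped L) (trans (cong (transpose u v) πL) (transpose-u {u} {v}))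
  same-below-v : ∀ {j} → val π' j < v → val π' j ≢ u → val π j ≡ val π' j
  same-below-v lt ≢u = val-unswapped π' π u<v swapped' ≢u (<⇒≢ lt)
  before-L' : ∀ j → val π' j < v → val π' j ≢ u → j F.< L
  before-L' j lt ≢u = before-L j (subst (_< v) (sym (same-below-v lt ≢u)) lt) (≢u ∘ trans (sym (same-below-v lt ≢u)))
  placement' : Placement π u v e L → Placement π' u v e L
  placement' (below-diagonal u≤e v≤L before-e) = below-diagonal u≤e v≤L λ j lt →
    before-e j (subst (_< u) (sym (same-below-v (<-trans lt u<v) (<⇒≢ lt))) lt)
  placement' (interlaced e<u u≤L L<v) = interlaced e<u u≤L L<v

ordered-positions : ∀ {n} (π : Perm n) {u v} → u ≢ v → 1 ≤ u → u ≤ n → 1 ≤ v → v ≤ n →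
  ∃₂ λ e L → e F.< L × HoldsPair π e L u v
ordered-positions π u≢v 1≤u u≤n 1≤v v≤n
  with val-surjective π 1≤u u≤n | val-surjective π 1≤v v≤n
... | p , πp | r , πr with FP.<-cmp p r
...   | tri< p<r _ _  = p , r , p<r , inj₁ (πp , πr)
...   | tri≈ _ refl _ = contradiction (trans (sym πp) πr) u≢v
...   | tri> _ _ r<p  = r , p , r<p , inj₂ (πr , πp)

late-positions : ∀ {n} (π : Perm n) {u v e L} k → HoldsPair π e L u v →
  (∀ j → toℕ j < k → val π j ≢ u × val π j ≢ v) → k ≤ toℕ e
late-positions π k holds avoid = ≮⇒≥ λ e<k → avoided e<k holds
  where
  avoided : ∀ {e L} → toℕ e < k → HoldsPair π e L _ _ → ⊥
  avoided e<k (inj₁ (πe , _)) = proj₁ (avoid _ e<k) πe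
  avoided e<k (inj₂ (πe , _)) = proj₂ (avoid _ e<k) πe

adjacent-between-above : ∀ {n} (π : Perm n) u → BetweenAbove π u (suc u)
adjacent-between-above π u i u<πi πi<1+u = contradiction u<πi (<⇒≱ πi<1+u)

val<2⇒≡1 : ∀ {n} (π : Perm n) {j} → val π j < 2 → val π j ≡ 1
val<2⇒≡1 π {j} lt = ≤-antisym (s≤s⁻¹ lt) (proj₁ (val-bounded π j))

parity-flips-below-diagonal : ∀ {n} (π π' : Perm n) {u v e L} k → u < v → Swapped π π' u v →
  e F.< L → HoldsPair π e L u v → u ≤ k → k ≤ toℕ e → v ≤ toℕ L →
  (∀ j → val π j < v → val π j ≢ u → toℕ j < val π j × toℕ j < k) → nwnm π % 2 ≢ nwnm π' % 2
parity-flips-below-diagonal π π' {u} {v} {e} k u<v swapped e<L holds u≤k k≤e v≤L small-early =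
  transpose-flips-nwnm-parity π π' u<v swapped between e<L holds
    (λ j lt ≢u → <-trans (before-k j lt ≢u) e<L)
    (below-diagonal (≤-trans u≤k k≤e) v≤L λ j lt → before-k j (<-trans lt u<v) (<⇒≢ lt))
  where
  between : BetweenAbove π u v
  between i u<πi πi<v = proj₁ (small-early i πi<v (<⇒≢ u<πi ∘ sym))
  before-k : ∀ j → val π j < v → val π j ≢ u → toℕ j < toℕ e
  before-k j lt ≢u = <-≤-trans (proj₂ (small-early j lt ≢u)) k≤e

data Partners : ℕ → ℕ → Set where
  one-two : Partners 1 2
  two-one : Partners 2 1

partners-sym : ∀ {a b} → Partners a b → Partners b a
partners-sym one-two = two-one
partners-sym two-one = one-two

partners-unique : ∀ {a b c} → Partners a b → Partners a c → b ≡ c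
partners-unique one-two one-two = refl
partners-unique two-one two-one = refl

partners-distinct : ∀ {a b} → Partners a b → a ≢ b
partners-distinct one-two ()
partners-distinct two-one ()

partner-≥1 : ∀ {a b} → Partners a b → 1 ≤ a
partner-≥1 one-two = s≤s z≤n
partner-≥1 two-one = s≤s z≤n

partner-≤2 : ∀ {a b} → Partners a b → a ≤ 2
partner-≤2 one-two = s≤s z≤n
partner-≤2 two-one = s≤s (s≤s z≤n)

partners-values : ∀ {a b} → Partners a b → (a ≡ 1 × b ≡ 2) ⊎ (a ≡ 2 × b ≡ 1)
partners-values one-two = inj₁ (refl , refl)
partners-values two-one = inj₂ (refl , refl)

partners-cover : ∀ {a b w} → Partners a b → 1 ≤ w → w < 3 → w ≡ a ⊎ w ≡ b
partners-cover {w = 1} one-two _ _ = inj₁ refl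
partners-cover {w = 2} one-two _ _ = inj₂ refl
partners-cover {w = 1} two-one _ _ = inj₂ refl
partners-cover {w = 2} two-one _ _ = inj₁ refl
partners-cover {w = suc (suc (suc _))} _ _ (s≤s (s≤s (s≤s ())))

partners-avoid : ∀ {a b w} → Partners a b → 1 ≤ w → w ≢ a → w ≢ b → 3 ≤ w
partners-avoid p 1≤w w≢a w≢b = ≮⇒≥ λ w<3 → [ w≢a , w≢b ] (partners-cover p 1≤w w<3)

partners-high : ∀ {a b} → Partners a b → a ≢ 1 → a ≢ 2 → ⊥
partners-high one-two a≢1 _ = a≢1 refl
partners-high two-one _ a≢2 = a≢2 refl

partner-not-≥3 : ∀ {a b x} → Partners a b → x ≡ b → 3 ≤ x → ⊥
partner-not-≥3 p refl 3≤b = <⇒≱ (s≤s (partner-≤2 (partners-sym p))) 3≤b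

partner? : ∀ a → ∃ (Partners a) ⊎ (a ≢ 1 × a ≢ 2)
partner? 0                   = inj₂ ((λ ()) , (λ ()))
partner? 1                   = inj₁ (2 , one-two)
partner? 2                   = inj₁ (1 , two-one)
partner? (suc (suc (suc _))) = inj₂ ((λ ()) , (λ ()))

partner-fixed : ∀ {a b v} → Partners a b → 3 ≤ v → transpose b v a ≡ a
partner-fixed p 3≤v = transpose-fixes (partners-distinct p) λ { refl → <⇒≱ (s≤s (partner-≤2 p)) 3≤v }

≥3-fixed : ∀ {a b v x} → Partners a b → 3 ≤ x → x ≢ v → transpose b v x ≡ x
≥3-fixed p 3≤x x≢v = transpose-fixes (λ x≡b → partner-not-≥3 p x≡b 3≤x) x≢v

Is34 : ℕ → ℕ → Set
Is34 x z = (x ≡ 3 × z ≡ 4) ⊎ (x ≡ 4 × z ≡ 3)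

is34? : ∀ x z → Dec (Is34 x z)
is34? x z = (x ≟ 3 ×-dec z ≟ 4) ⊎-dec (x ≟ 4 ×-dec z ≟ 3)

is34-≥3 : ∀ {x z} → Is34 x z → 3 ≤ x
is34-≥3 (inj₁ (refl , _)) = ≤-refl
is34-≥3 (inj₂ (refl , _)) = n≤1+n 3

Forbidden : ℕ → ℕ → ℕ → ℕ → Set
Forbidden a x y z = Partners a z × Is34 x y

data SwapRule (a x y z : ℕ) : ℕ → ℕ → Set where
  first-high   : a ≢ 1 → a ≢ 2 → SwapRule a x y z 1 2
  first-pair   : ∀ {b} → Partners a b → x ≡ b → SwapRule a x y z 1 2
  swap-3-4     : ∀ {b} → Partners a b → y ≡ b → Is34 x z → SwapRule a x y z 3 4
  second-large : ∀ {b} → Partners a b → 4 ≤ x → ¬ (y ≡ b × Is34 x z) → SwapRule a x y z b 3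
  second-three : ∀ {b} → Partners a b → x ≡ 3 → ¬ (y ≡ b × Is34 x z) → SwapRule a x y z b 4

swap-rule : ∀ a x y z → 1 ≤ x → x ≢ a → ∃₂ (SwapRule a x y z)
swap-rule a x y z 1≤x x≢a with partner? a
... | inj₂ (a≢1 , a≢2) = 1 , 2 , first-high a≢1 a≢2
... | inj₁ (b , p) with x ≟ b
...   | yes x≡b = 1 , 2 , first-pair p x≡b
...   | no x≢b with (y ≟ b) ×-dec is34? x z
...     | yes (y≡b , is34) = 3 , 4 , swap-3-4 p y≡b is34
...     | no ¬rule34 with x ≟ 3
...       | yes x≡3 = b , 4 , second-three p x≡3 ¬rule34
...       | no x≢3  = b , 3 , second-large p (≤∧≢⇒< (partners-avoid p 1≤x x≢a x≢b) (x≢3 ∘ sym)) ¬rule34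

swap-rule-unique : ∀ {a x y z u v u' v'} → SwapRule a x y z u v → SwapRule a x y z u' v' → u ≡ u' × v ≡ v'
swap-rule-unique (first-high _ _)        (first-high _ _)         = refl , refl
swap-rule-unique (first-high _ _)        (first-pair _ _)         = refl , refl
swap-rule-unique (first-high a≢1 a≢2)    (swap-3-4 p _ _)         = ⊥-elim (partners-high p a≢1 a≢2)
swap-rule-unique (first-high a≢1 a≢2)    (second-large p _ _)     = ⊥-elim (partners-high p a≢1 a≢2)
swap-rule-unique (first-high a≢1 a≢2)    (second-three p _ _)     = ⊥-elim (partners-high p a≢1 a≢2)
swap-rule-unique (first-pair _ _)        (first-high _ _)         = refl , refl
swap-rule-unique (first-pair _ _)        (first-pair _ _)         = refl , refl
swap-rule-unique (first-pair p x≡b)      (swap-3-4 _ _ is34)      = ⊥-elim (partner-not-≥3 p x≡b (is34-≥3 is34))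
swap-rule-unique (first-pair p x≡b)      (second-large _ 4≤x _)   = ⊥-elim (partner-not-≥3 p x≡b (≤-trans (n≤1+n 3) 4≤x))
swap-rule-unique (first-pair p x≡b)      (second-three _ x≡3 _)   = ⊥-elim (partner-not-≥3 p x≡b (≤-reflexive (sym x≡3)))
swap-rule-unique (swap-3-4 p _ _)        (first-high a≢1 a≢2)     = ⊥-elim (partners-high p a≢1 a≢2)
swap-rule-unique (swap-3-4 _ _ is34)     (first-pair p x≡b)       = ⊥-elim (partner-not-≥3 p x≡b (is34-≥3 is34))
swap-rule-unique (swap-3-4 _ _ _)        (swap-3-4 _ _ _)         = refl , refl
swap-rule-unique (swap-3-4 p y≡b is34)   (second-large p' _ ¬r)   = ⊥-elim (¬r (trans y≡b (partners-unique p p') , is34))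
swap-rule-unique (swap-3-4 p y≡b is34)   (second-three p' _ ¬r)   = ⊥-elim (¬r (trans y≡b (partners-unique p p') , is34))
swap-rule-unique (second-large p _ _)    (first-high a≢1 a≢2)     = ⊥-elim (partners-high p a≢1 a≢2)
swap-rule-unique (second-large _ 4≤x _)  (first-pair p x≡b)       = ⊥-elim (partner-not-≥3 p x≡b (≤-trans (n≤1+n 3) 4≤x))
swap-rule-unique (second-large p' _ ¬r)  (swap-3-4 p y≡b is34)    = ⊥-elim (¬r (trans y≡b (partners-unique p p') , is34))
swap-rule-unique (second-large p _ _)    (second-large p' _ _)    = partners-unique p p' , refl
swap-rule-unique (second-large _ 4≤x _)  (second-three _ refl _)  = ⊥-elim (<⇒≱ ≤-refl 4≤x)
swap-rule-unique (second-three p _ _)    (first-high a≢1 a≢2)     = ⊥-elim (partners-high p a≢1 a≢2)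
swap-rule-unique (second-three _ x≡3 _)  (first-pair p x≡b)       = ⊥-elim (partner-not-≥3 p x≡b (≤-reflexive (sym x≡3)))
swap-rule-unique (second-three p' _ ¬r)  (swap-3-4 p y≡b is34)    = ⊥-elim (¬r (trans y≡b (partners-unique p p') , is34))
swap-rule-unique (second-three _ refl _) (second-large _ 4≤x _)   = ⊥-elim (<⇒≱ ≤-refl 4≤x)
swap-rule-unique (second-three p _ _)    (second-three p' _ _)    = partners-unique p p' , refl

swap-rule-bounds : ∀ {a x y z u v} → SwapRule a x y z u v → 1 ≤ u × u < v × v ≤ 4
swap-rule-bounds (first-high _ _)     = s≤s z≤n , ≤-refl , s≤s (s≤s z≤n)
swap-rule-bounds (first-pair _ _)     = s≤s z≤n , ≤-refl , s≤s (s≤s z≤n)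
swap-rule-bounds (swap-3-4 _ _ _)     = s≤s z≤n , ≤-refl , ≤-refl
swap-rule-bounds (second-large p _ _) = partner-≥1 (partners-sym p) , s≤s (partner-≤2 (partners-sym p)) , n≤1+n 3
swap-rule-bounds (second-three p _ _) = partner-≥1 (partners-sym p) , s≤s (≤-trans (partner-≤2 (partners-sym p)) (n≤1+n 2)) , ≤-refl

swap-rule-transpose : ∀ {a x y z u v} → SwapRule a x y z u v → ¬ Forbidden a x y z →
  SwapRule (transpose u v a) (transpose u v x) (transpose u v y) (transpose u v z) u v
swap-rule-transpose (first-high a≢1 a≢2) _ = first-high (a≢1 ∘ trans (sym sa)) (a≢2 ∘ trans (sym sa))
  where sa = transpose-fixes a≢1 a≢2
swap-rule-transpose (first-pair one-two refl) _ = first-pair two-one refl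
swap-rule-transpose (first-pair two-one refl) _ = first-pair one-two refl
swap-rule-transpose (swap-3-4 one-two refl (inj₁ (refl , refl))) _ = swap-3-4 one-two refl (inj₂ (refl , refl))
swap-rule-transpose (swap-3-4 one-two refl (inj₂ (refl , refl))) _ = swap-3-4 one-two refl (inj₁ (refl , refl))
swap-rule-transpose (swap-3-4 two-one refl (inj₁ (refl , refl))) _ = swap-3-4 two-one refl (inj₂ (refl , refl))
swap-rule-transpose (swap-3-4 two-one refl (inj₂ (refl , refl))) _ = swap-3-4 two-one refl (inj₁ (refl , refl))
swap-rule-transpose {a} {x} {y} {z} (second-large {b} p 4≤x ¬r) ¬forbidden =
  second-large (subst (λ t → Partners t b) (sym sa) p) (subst (4 ≤_) (sym sx) 4≤x) ¬r'
  where
  sa = partner-fixed p ≤-refl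
  sx = ≥3-fixed p (≤-trans (n≤1+n 3) 4≤x) (λ { refl → <⇒≱ ≤-refl 4≤x })
  -- the image would match rule swap-3-4 only if π itself started with a 4 3 b, which is forbidden
  ¬r' : ¬ (transpose b 3 y ≡ b × Is34 (transpose b 3 x) (transpose b 3 z))
  ¬r' (sy≡b , is34) with subst (λ t → Is34 t (transpose b 3 z)) sx is34
  ... | inj₁ (refl , _)    = <⇒≱ ≤-refl 4≤x
  ... | inj₂ (x≡4 , sz≡3) = ¬forbidden (subst (Partners a) (sym z≡b) p , inj₂ (x≡4 , y≡3))
    where
    y≡3 = trans (transpose-inverse sy≡b) (transpose-u {b} {3})
    z≡b = trans (transpose-inverse sz≡3) (transpose-v {b} {3})
swap-rule-transpose {a} {x} {y} {z} (second-three {b} p refl ¬r) ¬forbidden =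
  second-three (subst (λ t → Partners t b) (sym sa) p) sx ¬r'
  where
  sa = partner-fixed p (n≤1+n 3)
  sx = ≥3-fixed p ≤-refl (λ ())
  ¬r' : ¬ (transpose b 4 y ≡ b × Is34 (transpose b 4 3) (transpose b 4 z))
  ¬r' (sy≡b , is34) with subst (λ t → Is34 t (transpose b 4 z)) sx is34
  ... | inj₁ (_ , sz≡4) = ¬forbidden (subst (Partners a) (sym z≡b) p , inj₁ (refl , y≡4))
    where
    y≡4 = trans (transpose-inverse sy≡b) (transpose-u {b} {4})
    z≡b = trans (transpose-inverse sz≡4) (transpose-v {b} {4})

swap-rule-transpose-allowed : ∀ {a x y z u v} → SwapRule a x y z u v →
  ¬ Forbidden (transpose u v a) (transpose u v x) (transpose u v y) (transpose u v z)
swap-rule-transpose-allowed (first-high a≢1 a≢2) (p , _) =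
  partners-high p (a≢1 ∘ trans (sym sa)) (a≢2 ∘ trans (sym sa))
  where sa = transpose-fixes a≢1 a≢2
swap-rule-transpose-allowed (first-pair one-two refl) (_ , inj₁ (() , _))
swap-rule-transpose-allowed (first-pair one-two refl) (_ , inj₂ (() , _))
swap-rule-transpose-allowed (first-pair two-one refl) (_ , inj₁ (() , _))
swap-rule-transpose-allowed (first-pair two-one refl) (_ , inj₂ (() , _))
swap-rule-transpose-allowed (swap-3-4 one-two refl _) (_ , inj₁ (_ , ()))
swap-rule-transpose-allowed (swap-3-4 one-two refl _) (_ , inj₂ (_ , ()))
swap-rule-transpose-allowed (swap-3-4 two-one refl _) (_ , inj₁ (_ , ()))
swap-rule-transpose-allowed (swap-3-4 two-one refl _) (_ , inj₂ (_ , ()))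
swap-rule-transpose-allowed {a} {x} {y} {z} (second-large {b} p 4≤x ¬r) (p' , is34)
  with subst (λ t → Is34 t (transpose b 3 y)) (≥3-fixed p (≤-trans (n≤1+n 3) 4≤x) λ { refl → <⇒≱ ≤-refl 4≤x }) is34
... | inj₁ (refl , _)    = <⇒≱ ≤-refl 4≤x
... | inj₂ (x≡4 , sy≡3) = ¬r (y≡b , inj₂ (x≡4 , z≡3))
  where
  y≡b = trans (transpose-inverse sy≡3) (transpose-v {b} {3})
  sz≡b = partners-unique (subst (λ t → Partners t _) (partner-fixed p ≤-refl) p') p
  z≡3 = trans (transpose-inverse sz≡b) (transpose-u {b} {3})
swap-rule-transpose-allowed {a} {x} {y} {z} (second-three {b} p refl ¬r) (p' , is34)
  with subst (λ t → Is34 t (transpose b 4 y)) (≥3-fixed p ≤-refl λ ()) is34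
... | inj₁ (_ , sy≡4) = ¬r (y≡b , inj₁ (refl , z≡4))
  where
  y≡b = trans (transpose-inverse sy≡4) (transpose-v {b} {4})
  sz≡b = partners-unique (subst (λ t → Partners t _) (partner-fixed p (n≤1+n 3)) p') p
  z≡4 = trans (transpose-inverse sz≡b) (transpose-u {b} {4})

module _ {m} (π π' : Perm (4 + m)) where

  private
    ≤n : ∀ {w} → w ≤ 4 → w ≤ 4 + m
    ≤n w≤4 = ≤-trans w≤4 (m≤m+n 4 m)

    below-3-first : ∀ {b j} → Partners (val π 0F) b → val π j < 3 → val π j ≢ b → j ≡ 0F
    below-3-first p lt ≢b with partners-cover p (proj₁ (val-bounded π _)) lt
    ... | inj₁ at-a = val-injective π at-a
    ... | inj₂ at-b = contradiction at-b ≢b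

  first-high-flips : val π 0F ≢ 1 → val π 0F ≢ 2 → Swapped π π' 1 2 → nwnm π % 2 ≢ nwnm π' % 2
  first-high-flips a≢1 a≢2 swapped
    with ordered-positions π (λ ()) (s≤s z≤n) (≤n (s≤s z≤n)) (s≤s z≤n) (≤n (s≤s (s≤s z≤n)))
  ... | e , L , e<L , holds =
    parity-flips-below-diagonal π π' 1 ≤-refl swapped e<L holds ≤-refl 1≤e (≤-trans (s≤s 1≤e) e<L)
      λ j lt ≢1 → contradiction (val<2⇒≡1 π lt) ≢1
    where
    1≤e : 1 ≤ toℕ e
    1≤e = late-positions π 1 holds λ { 0F _ → a≢1 , a≢2 ; (F.suc _) (s≤s ()) }

  first-pair-flips : ∀ {b} → Partners (val π 0F) b → val π 1F ≡ b → Swapped π π' 1 2 → nwnm π % 2 ≢ nwnm π' % 2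
  first-pair-flips p x≡b swapped =
    transpose-flips-nwnm-parity π π' ≤-refl swapped (adjacent-between-above π 1) {0F} {1F} (s≤s z≤n)
      first-two (λ j lt ≢1 → contradiction (val<2⇒≡1 π lt) ≢1) (interlaced (s≤s z≤n) ≤-refl ≤-refl)
    where
    first-two : HoldsPair π 0F 1F 1 2
    first-two with partners-values p
    ... | inj₁ (a≡1 , b≡2) = inj₁ (a≡1 , trans x≡b b≡2)
    ... | inj₂ (a≡2 , b≡1) = inj₂ (a≡2 , trans x≡b b≡1)

  swap-3-4-flips : ∀ {b} → Partners (val π 0F) b → val π 2F ≡ b → Is34 (val π 1F) (val π 3F) → Swapped π π' 3 4 →
                   nwnm π % 2 ≢ nwnm π' % 2
  swap-3-4-flips p y≡b is34 swapped =
    transpose-flips-nwnm-parity π π' ≤-refl swapped (adjacent-between-above π 3) {1F} {3F} (s≤s (s≤s z≤n))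
      is34 before-3 (interlaced (s≤s (s≤s z≤n)) ≤-refl ≤-refl)
    where
    before-3 : ∀ j → val π j < 4 → val π j ≢ 3 → toℕ j < 3
    before-3 j lt ≢3 with partners-cover p (proj₁ (val-bounded π j)) (≤∧≢⇒< (s≤s⁻¹ lt) ≢3)
    ... | inj₁ at-a with refl ← val-injective π at-a = s≤s z≤n
    before-3 j lt ≢3 | inj₂ at-b with refl ← val-injective π (trans at-b (sym y≡b)) = s≤s (s≤s (s≤s z≤n))

  second-large-flips : ∀ {b} → Partners (val π 0F) b → 4 ≤ val π 1F → Swapped π π' b 3 → nwnm π % 2 ≢ nwnm π' % 2
  second-large-flips {b} p 4≤x swapped =
    flips (ordered-positions π (<⇒≢ b<3) (partner-≥1 p') (≤n (≤-trans b≤2 (m≤m+n 2 2))) (s≤s z≤n) (≤n (n≤1+n 3)))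
    where
    p' = partners-sym p
    b≤2 = partner-≤2 p'
    b<3 = s≤s b≤2
    early : ∀ j → val π j < 3 → val π j ≢ b → toℕ j < val π j × toℕ j < 2
    early j lt ≢b with refl ← below-3-first p lt ≢b = proj₁ (val-bounded π 0F) , s≤s z≤n
    flips : (∃₂ λ e L → e F.< L × HoldsPair π e L b 3) → nwnm π % 2 ≢ nwnm π' % 2
    flips (e , L , e<L , holds) =
      parity-flips-below-diagonal π π' 2 b<3 swapped e<L holds b≤2 2≤e (≤-trans (s≤s 2≤e) e<L) early
      where
      2≤e : 2 ≤ toℕ e
      2≤e = late-positions π 2 holds λ
        { 0F _ → partners-distinct p , <⇒≢ (s≤s (partner-≤2 p))
        ; 1F _ → (λ x≡b → partner-not-≥3 p x≡b (≤-trans (n≤1+n 3) 4≤x)) , (λ x≡3 → <⇒≱ ≤-refl (subst (4 ≤_) x≡3 4≤x))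
        ; (F.suc (F.suc _)) (s≤s (s≤s ())) }

  second-three-flips : ∀ {b} → Partners (val π 0F) b → val π 1F ≡ 3 → ¬ (val π 2F ≡ b × Is34 (val π 1F) (val π 3F)) →
    ¬ Forbidden (val π 0F) (val π 1F) (val π 2F) (val π 3F) → Swapped π π' b 4 → nwnm π % 2 ≢ nwnm π' % 2
  second-three-flips {b} p x≡3 ¬r not-forbidden swapped =
    flips (ordered-positions π (<⇒≢ b<4) (partner-≥1 p') (≤n (<⇒≤ b<4)) (s≤s z≤n) (≤n ≤-refl))
    where
    p' = partners-sym p
    b≤2 = partner-≤2 p'
    b<4 = s≤s (≤-trans b≤2 (n≤1+n 2))
    early : ∀ j → val π j < 4 → val π j ≢ b → toℕ j < val π j × toℕ j < 2
    early j lt ≢b with val π j ≟ 3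
    ... | yes πj≡3 with refl ← val-injective π (trans πj≡3 (sym x≡3)) = subst (1 <_) (sym πj≡3) (s≤s (s≤s z≤n)) , ≤-refl
    ... | no πj≢3 with refl ← below-3-first p (≤∧≢⇒< (s≤s⁻¹ lt) πj≢3) ≢b = proj₁ (val-bounded π 0F) , s≤s z≤n
    -- b and 4 at positions 2 and 3 would make the prefix either match swap-3-4 or be forbidden
    not-at-2-3 : ∀ {e L} → e F.< L → 2 ≤ toℕ e → HoldsPair π e L b 4 → 4 ≤ toℕ L
    not-at-2-3 {e} {L} e<L 2≤e holds with toℕ L ≟ 3
    ... | no L≢3 = ≤∧≢⇒< (≤-trans (s≤s 2≤e) e<L) (L≢3 ∘ sym)
    ... | yes L≡3 with refl ← FP.toℕ-injective {i = L} {j = 3F} L≡3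
                   | refl ← FP.toℕ-injective {i = e} {j = 2F} (≤-antisym (s≤s⁻¹ (subst (toℕ e <_) L≡3 e<L)) 2≤e)
                   with holds
    ...   | inj₁ (y≡b , z≡4) = contradiction (y≡b , inj₁ (x≡3 , z≡4)) ¬r
    ...   | inj₂ (y≡4 , z≡b) = contradiction (subst (Partners _) (sym z≡b) p , inj₁ (x≡3 , y≡4)) not-forbidden
    flips : (∃₂ λ e L → e F.< L × HoldsPair π e L b 4) → nwnm π % 2 ≢ nwnm π' % 2
    flips (e , L , e<L , holds) =
      parity-flips-below-diagonal π π' 2 b<4 swapped e<L holds b≤2 2≤e (not-at-2-3 e<L 2≤e holds) early
      where
      2≤e : 2 ≤ toℕ e
      2≤e = late-positions π 2 holds λ
        { 0F _ → partners-distinct p , <⇒≢ (≤-trans (s≤s (partner-≤2 p)) (n≤1+n 3))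
        ; 1F _ → (λ x≡b → partner-not-≥3 p x≡b (≤-reflexive (sym x≡3))) , (λ x≡4 → contradiction (trans (sym x≡3) x≡4) λ ())
        ; (F.suc (F.suc _)) (s≤s (s≤s ())) }

  swap-rule-flips-parity : ∀ {u v} → SwapRule (val π 0F) (val π 1F) (val π 2F) (val π 3F) u v →
    ¬ Forbidden (val π 0F) (val π 1F) (val π 2F) (val π 3F) → Swapped π π' u v → nwnm π % 2 ≢ nwnm π' % 2
  swap-rule-flips-parity (first-high a≢1 a≢2)  _             = first-high-flips a≢1 a≢2
  swap-rule-flips-parity (first-pair p x≡b)    _             = first-pair-flips p x≡b
  swap-rule-flips-parity (swap-3-4 p y≡b is34) _             = swap-3-4-flips p y≡b is34
  swap-rule-flips-parity (second-large p 4≤x _) _            = second-large-flips p 4≤x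
  swap-rule-flips-parity (second-three p x≡3 ¬r) not-forbidden = second-three-flips p x≡3 ¬r not-forbidden

transpose-isPerm : ∀ {n u v} (w : Vec ℕ n) → 1 ≤ u → u ≤ n → 1 ≤ v → v ≤ n →
                   IsPerm n w → IsPerm n (map (transpose u v) w)
transpose-isPerm {n} {u} {v} w 1≤u u≤n 1≤v v≤n (bounded , unique) =
  subst (All InRange) (sym (toList-map _ w)) (All.map⁺ (All.map stays-in-range bounded)) ,
  subst Unique (sym (toList-map _ w)) (Unique.map⁺ transpose-injective unique)
  where
  InRange : ℕ → Set
  InRange x = 1 ≤ x × x ≤ n
  stays-in-range : ∀ {x} → InRange x → InRange (transpose u v x)
  stays-in-range {x} in-range with x ≟ u
  ... | yes _ = 1≤v , v≤n
  ... | no _ with x ≟ v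
  ...   | yes _ = 1≤u , u≤n
  ...   | no _  = in-range

map-transpose-involutive : ∀ {n u v} (w : Vec ℕ n) → map (transpose u v) (map (transpose u v) w) ≡ w
map-transpose-involutive w = trans (sym (map-∘ _ _ w)) (trans (map-cong transpose-involutive w) (map-id w))

RuleFor : ∀ {m} → Vec ℕ (4 + m) → ℕ → ℕ → Set
RuleFor (a ∷ x ∷ y ∷ z ∷ _) = SwapRule a x y z

bad-prefix⇒forbidden : ∀ {m a x y z} {rest : Vec ℕ m} → BadPrefix (a ∷ x ∷ y ∷ z ∷ rest) → Forbidden a x y z
bad-prefix⇒forbidden (inj₁ (refl , refl , refl , refl))               = one-two , inj₁ (refl , refl)
bad-prefix⇒forbidden (inj₂ (inj₁ (refl , refl , refl , refl)))        = one-two , inj₂ (refl , refl)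
bad-prefix⇒forbidden (inj₂ (inj₂ (inj₁ (refl , refl , refl , refl)))) = two-one , inj₁ (refl , refl)
bad-prefix⇒forbidden (inj₂ (inj₂ (inj₂ (refl , refl , refl , refl)))) = two-one , inj₂ (refl , refl)

forbidden⇒bad-prefix : ∀ {m a x y z} {rest : Vec ℕ m} → Forbidden a x y z → BadPrefix (a ∷ x ∷ y ∷ z ∷ rest)
forbidden⇒bad-prefix (one-two , inj₁ (refl , refl)) = inj₁ (refl , refl , refl , refl)
forbidden⇒bad-prefix (one-two , inj₂ (refl , refl)) = inj₂ (inj₁ (refl , refl , refl , refl))
forbidden⇒bad-prefix (two-one , inj₁ (refl , refl)) = inj₂ (inj₂ (inj₁ (refl , refl , refl , refl)))
forbidden⇒bad-prefix (two-one , inj₂ (refl , refl)) = inj₂ (inj₂ (inj₂ (refl , refl , refl , refl)))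

chosen-rule : ∀ {m} (π : W m) → ∃₂ (RuleFor (word π))
chosen-rule (π@((a ∷ x ∷ y ∷ z ∷ _) , _) , _) =
  swap-rule a x y z (proj₁ (val-bounded π 1F)) (λ x≡a → contradiction (val-injective π {1F} {0F} x≡a) λ ())

transposed : ∀ {m} (π : W m) {u v} → RuleFor (word π) u v → W m
transposed {m} (((a ∷ x ∷ y ∷ z ∷ rest) , isPerm) , _) {u} {v} rule =
  (map (transpose u v) w , transpose-isPerm w 1≤u (≤4+m (≤-trans (<⇒≤ u<v) v≤4)) (≤-trans 1≤u (<⇒≤ u<v)) (≤4+m v≤4) isPerm) ,
  λ bad → swap-rule-transpose-allowed rule (bad-prefix⇒forbidden {rest = map (transpose u v) rest} bad)
  where
  w = a ∷ x ∷ y ∷ z ∷ rest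
  ≤4+m : ∀ {k} → k ≤ 4 → k ≤ 4 + m
  ≤4+m k≤4 = ≤-trans k≤4 (m≤m+n 4 m)
  1≤u = proj₁ (swap-rule-bounds rule)
  u<v = proj₁ (proj₂ (swap-rule-bounds rule))
  v≤4 = proj₂ (proj₂ (swap-rule-bounds rule))

φ : ∀ {m} → W m → W m
φ π = transposed π (proj₂ (proj₂ (chosen-rule π)))

transposed-involutive : ∀ {m} (w : Vec ℕ (4 + m)) {u v u' v'} → RuleFor w u v → ¬ BadPrefix w →
  RuleFor (map (transpose u v) w) u' v' → map (transpose u' v') (map (transpose u v) w) ≡ w
transposed-involutive (a ∷ x ∷ y ∷ z ∷ rest) rule allowed rule'
  with refl , refl ← swap-rule-unique rule' (swap-rule-transpose rule (allowed ∘ forbidden⇒bad-prefix {rest = rest}))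
  = map-transpose-involutive (a ∷ x ∷ y ∷ z ∷ rest)

φ-involutive : ∀ {m} (π : W m) → word (φ (φ π)) ≡ word π
φ-involutive π@(((_ ∷ _ ∷ _ ∷ _ ∷ _) , _) , allowed) =
  transposed-involutive (word π) (proj₂ (proj₂ (chosen-rule π))) allowed (proj₂ (proj₂ (chosen-rule (φ π))))

φ-flips-parity : ∀ {m} (π : W m) → nwnm (perm π) % 2 ≢ nwnm (perm (φ π)) % 2
φ-flips-parity π@(((_ ∷ _ ∷ _ ∷ _ ∷ rest) , _) , allowed) =
  swap-rule-flips-parity (perm π) (perm (φ π)) (proj₂ (proj₂ (chosen-rule π))) (allowed ∘ forbidden⇒bad-prefix {rest = rest})
    λ i → lookup-map i _ (word π)

lemma2p4 : (m : ℕ) → Σ (W m → W m) λ φ →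
    ((π : W m) → word (φ (φ π)) ≡ word π) ×
    ((π : W m) → nwnm (perm π) % 2 ≢ nwnm (perm (φ π)) % 2)
lemma2p4 m = φ , φ-involutive , φ-flips-parity
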